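{- Let $G=(V_1,V_2,E)$ be a game structure and $p\colon V\to\{0,1,2\}$ a priority function. For all $\lambda\in\mathbb{N}_0$, $\mathsf{FixPR}(\lambda,p)=\mathsf{FixWP}(\lambda,p)$ and $\mathsf{DirFixPR}(\lambda,p)=\mathsf{DirFixWP}(\lambda,p)$.
   Context: A game structure is $G=(V_1,V_2,E)$ with $V=V_1\cup V_2$ finite (disjoint union), $E\subseteq V\times V$, every vertex having an outgoing edge. A play is an infinite sequence $\pi=v_0v_1\dots$ with $(v_k,v_{k+1})\in E$; $\pi[k]=v_k$, $\pi[k,\infty]=v_kv_{k+1}\dots$. $\mathbb{N}_0$ denotes the positive integers. For priorities, $c\preceq c'$ iff $c$ is even and $c\le c'$. For $\lambda\in\mathbb{N}_0$: $\mathsf{DirFixPR}(\lambda,p)=\{\pi\mid\forall j\ge0\ \exists l\in\{0,\dots,\lambda-1\}:\ p(\pi[j+l])\preceq p(\pi[j])\}$; $\mathsf{DirFixWP}(\lambda,p)=\{\pi\mid\forall j\ge0\ \exists l\in\{0,\dots,\lambda-1\}\ \forall k\in\{0,\dots,l\}:\ p(\pi[j+l])\preceq p(\pi[j+k])\}$; for $\mathsf{X}\in\{\mathsf{PR},\mathsf{WP}\}$, $\mathsf{FixX}(\lambda,p)=\{\pi\mid\exists i\ge0:\ \pi[i,\infty]\in\mathsf{DirFixX}(\lambda,p)\}$. -}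

module Defs where

open import Data.Nat using (ℕ; zero; suc; _+_; _≤_; _<_)
open import Data.Nat.Properties using ()
open import Data.Fin using (Fin)
open import Data.Bool using (Bool)
open import Data.Product using (Σ; ∃; ∃-syntax; _×_; _,_)
open import Relation.Nullary using (¬_)
open import Relation.Binary.PropositionalEquality using (_≡_)
open import Level using (0ℓ)

data Even : ℕ → Set where
  even-zero : Even zero
  even-ss   : ∀ {n} → Even n → Even (suc (suc n))

_⪯_ : ℕ → ℕ → Set
c ⪯ c' = Even c × c ≤ c'

-- A game structure G = (V₁, V₂, E) with finite vertex set V = Fin n.
-- The partition V = V₁ ⊎ V₂ is given by `owner` (true = player 1).
-- Every vertex has an outgoing edge.
record GameStructure : Set₁ where
  field
    n         : ℕ
    owner     : Fin n → Bool
    E         : Fin n → Fin n → Set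
    total     : ∀ v → ∃[ w ] E v w

module _ (G : GameStructure) where
  open GameStructure G

  Vertex : Set
  Vertex = Fin n

  record Play : Set where
    field
      seq   : ℕ → Fin n
      edges : ∀ k → E (seq k) (seq (suc k))

  open Play public

  suffix : Play → ℕ → Play
  suffix π i = record { seq = λ k → seq π (i + k) ; edges = λ k → edgeSuf k }
    where
      edgeSuf : ∀ k → E (seq π (i + k)) (seq π (i + suc k))
      edgeSuf k rewrite Data.Nat.Properties.+-suc i k = edges π (i + k)

  DirFixPR : ℕ → (Fin n → ℕ) → Play → Set
  DirFixPR λ' p π =
    ∀ j → ∃[ l ] (l < λ' × p (seq π (j + l)) ⪯ p (seq π j))

  DirFixWP : ℕ → (Fin n → ℕ) → Play → Set
  DirFixWP λ' p π =
    ∀ j → ∃[ l ] (l < λ' × (∀ k → k ≤ l → p (seq π (j + l)) ⪯ p (seq π (j + k))))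

  FixPR : ℕ → (Fin n → ℕ) → Play → Set
  FixPR λ' p π = ∃[ i ] DirFixPR λ' p (suffix π i)

  FixWP : ℕ → (Fin n → ℕ) → Play → Set
  FixWP λ' p π = ∃[ i ] DirFixWP λ' p (suffix π i)

module Submission where

-- With priorities in {0, 1, 2}, a response c' ⪯ c is either 0, which answers every
-- priority and so closes the window at the same offset, or 2 = c, in which case the
-- window closes immediately at offset 0 because c is even. The converse inclusion
-- holds for any priorities, by taking k = 0 in the window condition.

open import Defs
open import Data.Nat using (ℕ; zero; _+_; _≤_; _<_; z≤n; s≤s)
open import Data.Nat.Properties using (+-identityʳ; ≤-refl)
open import Data.Fin using (Fin)
open import Data.Product using (_×_; _,_; ∃-syntax; map₂)
open import Data.Sum using (_⊎_; inj₁; inj₂)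
open import Function.Bundles using (_⇔_; mk⇔; Equivalence)
open import Relation.Binary.PropositionalEquality using (_≡_; refl; sym; cong; subst)

0⪯ : ∀ c → 0 ⪯ c
0⪯ c = even-zero , z≤n

⪯-refl : ∀ {c} → Even c → c ⪯ c
⪯-refl ev = ev , ≤-refl

⪯-≤2⇒≡0⊎Even : ∀ {c' c} → c ≤ 2 → c' ⪯ c → c' ≡ 0 ⊎ Even c
⪯-≤2⇒≡0⊎Even _               (even-zero , _)                    = inj₁ refl
⪯-≤2⇒≡0⊎Even (s≤s (s≤s z≤n)) (even-ss even-zero , s≤s (s≤s z≤n)) = inj₂ (even-ss even-zero)

DirPR : ℕ → (ℕ → ℕ) → Set
DirPR λ' f = ∀ j → ∃[ l ] (l < λ' × f (j + l) ⪯ f j)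

DirWP : ℕ → (ℕ → ℕ) → Set
DirWP λ' f = ∀ j → ∃[ l ] (l < λ' × (∀ k → k ≤ l → f (j + l) ⪯ f (j + k)))

DirWP⇒DirPR : ∀ {λ'} f → DirWP λ' f → DirPR λ' f
DirWP⇒DirPR f wp j with wp j
... | l , l<λ , closes = l , l<λ , subst (λ i → f (j + l) ⪯ f i) (+-identityʳ j) (closes 0 z≤n)

DirPR⇒DirWP : ∀ {λ'} f → 0 < λ' → (∀ k → f k ≤ 2) → DirPR λ' f → DirWP λ' f
DirPR⇒DirWP f 0<λ f≤2 pr j with pr j
... | l , l<λ , resp with ⪯-≤2⇒≡0⊎Even (f≤2 j) resp
...   | inj₁ f[j+l]≡0 = l , l<λ , λ k _ → subst (_⪯ f (j + k)) (sym f[j+l]≡0) (0⪯ _)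
...   | inj₂ even-fj  = 0 , 0<λ , closesAt0
  where
  closesAt0 : ∀ k → k ≤ 0 → f (j + 0) ⪯ f (j + k)
  closesAt0 zero z≤n = ⪯-refl (subst Even (cong f (sym (+-identityʳ j))) even-fj)

DirPR⇔DirWP : ∀ {λ'} f → 0 < λ' → (∀ k → f k ≤ 2) → DirPR λ' f ⇔ DirWP λ' f
DirPR⇔DirWP f 0<λ f≤2 = mk⇔ (DirPR⇒DirWP f 0<λ f≤2) (DirWP⇒DirPR f)

lemma2 : (G : GameStructure) → (p : Fin (GameStructure.n G) → ℕ) →
         (∀ v → p v ≤ 2) → (λ' : ℕ) → 0 < λ' →
         (∀ (π : Play G) → (FixPR G λ' p π ⇔ FixWP G λ' p π))
         × (∀ (π : Play G) → (DirFixPR G λ' p π ⇔ DirFixWP G λ' p π))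
lemma2 G p p≤2 λ' 0<λ = fix , dir
  where
  dir : ∀ π → DirFixPR G λ' p π ⇔ DirFixWP G λ' p π
  dir π = DirPR⇔DirWP (λ k → p (seq π k)) 0<λ (λ k → p≤2 _)

  fix : ∀ π → FixPR G λ' p π ⇔ FixWP G λ' p π
  fix π = mk⇔ (map₂ λ {i} → Equivalence.to (dir (suffix G π i)))
              (map₂ λ {i} → Equivalence.from (dir (suffix G π i)))
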